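{- Let $n\geq 2$ and let $a=(a_1,\dots,a_n)$ be positive integers with $a_1\geq a_2\geq\dots\geq a_n$ and $\prod_{i=1}^n a_i=\sum_{i=1}^n a_i$. Then for every $1\leq k\leq n$, $$\prod_{i=1}^k a_i\leq \sum_{i=1}^k a_i+n-k.$$ Moreover, if $k_\star$ denotes the greatest index $k$ with $a_k>1$, then this inequality holds with equality for $k\geq k_\star$ and holds strictly for $k<k_\star$. -}

module Defs where

open import Data.Nat using (ℕ)
open import Data.Fin using (Fin)
open import Data.List using (take; tabulate)
open import Data.Nat.ListAction using (sum; product)

-- Sequences a = (a_1,…,a_n) are functions Fin n → ℕ, with Fin index i
-- representing the paper's index toℕ i + 1.

prefixProd : ∀ {n} → (Fin n → ℕ) → ℕ → ℕ
prefixProd a k = product (take k (tabulate a))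

prefixSum : ∀ {n} → (Fin n → ℕ) → ℕ → ℕ
prefixSum a k = sum (take k (tabulate a))

-- Write P_k = a_1⋯a_k and B_k = a_1 + ⋯ + a_k + (n − k).  Appending a factor x to the
-- prefix changes the excess P_k − B_k by (P_k − 1)(x − 1) ≥ 0, so the excess is
-- nondecreasing in k; it vanishes at k = n because the product equals the sum.  Hence it
-- is ≤ 0 everywhere, it is constant (= 0) once only 1s are appended, and each step that
-- appends a factor ≥ 2 to a product ≥ 2 is strict.
module Submission where

open import Defs
open import Level using (Level)
open import Data.Nat using (ℕ; >-nonZero; zero; suc; _+_; _*_; _∸_; _≤_; _<_; _≥_; _≤′_; ≤′-refl; ≤′-step; s≤s)
open import Data.Nat.Properties
open import Data.Integer using (ℤ; _⊖_; 0ℤ)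
  renaming (_≤_ to _≤ℤ_; _<_ to _<ℤ_)
import Data.Integer.Properties as ℤ
open import Data.Fin as Fin using (Fin; toℕ; fromℕ<)
open import Data.Fin.Properties using (toℕ-fromℕ<; toℕ<n)
open import Data.Product using (_×_; _,_)
open import Function using (_∘_)
open import Relation.Binary.Core using (Rel)
open import Relation.Binary.Definitions using (Reflexive; Transitive)
open import Relation.Binary.PropositionalEquality
open import Data.Nat.Tactic.RingSolver using (solve-∀)

module _ {ℓa ℓ : Level} {A : Set ℓa} {_∼_ : Rel A ℓ}
         (∼-refl : Reflexive _∼_) (∼-trans : Transitive _∼_) (f : ℕ → A) where

  stepwise⇒related : ∀ {k m} → (∀ i → k ≤ i → i < m → f i ∼ f (suc i)) → k ≤ m → f k ∼ f m
  stepwise⇒related step k≤m = go step (≤⇒≤′ k≤m)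
    where
    go : ∀ {k m} → (∀ i → k ≤ i → i < m → f i ∼ f (suc i)) → k ≤′ m → f k ∼ f m
    go step ≤′-refl = ∼-refl
    go step (≤′-step {m} k≤′m) =
      ∼-trans (go (λ i k≤i i<m → step i k≤i (m<n⇒m<1+n i<m)) k≤′m) (step m (≤′⇒≤ k≤′m) ≤-refl)

m+n≡o+p⇒n⊖o≡p⊖m : ∀ {m n o p} → m + n ≡ o + p → n ⊖ o ≡ p ⊖ m
m+n≡o+p⇒n⊖o≡p⊖m {m} {n} {o} {p} eq = begin
  n ⊖ o             ≡⟨ sym (ℤ.+-cancelˡ-⊖ m n o) ⟩
  (m + n) ⊖ (m + o) ≡⟨ cong₂ _⊖_ eq (+-comm m o) ⟩
  (o + p) ⊖ (o + m) ≡⟨ ℤ.+-cancelˡ-⊖ o p m ⟩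
  p ⊖ m             ∎
  where open ≡-Reasoning

m⊖n≤0⇒m≤n : ∀ {m n} → m ⊖ n ≤ℤ 0ℤ → m ≤ n
m⊖n≤0⇒m≤n {m} {n} h = ℤ.drop‿+≤+ (ℤ.i-j≤0⇒i≤j (subst (_≤ℤ 0ℤ) (sym (ℤ.[+m]-[+n]≡m⊖n m n)) h))

m⊖n≡0⇒m≡n : ∀ {m n} → m ⊖ n ≡ 0ℤ → m ≡ n
m⊖n≡0⇒m≡n {m} {n} h = ℤ.+-injective (ℤ.i-j≡0⇒i≡j _ _ (trans (ℤ.[+m]-[+n]≡m⊖n m n) h))

m⊖n<0⇒m<n : ∀ {m n} → m ⊖ n <ℤ 0ℤ → m < n
m⊖n<0⇒m<n {m} {n} h = ≰⇒> λ n≤m →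
  ℤ.<⇒≱ h (subst (_≤ℤ m ⊖ n) (ℤ.n⊖n≡0 n) (ℤ.⊖-monoˡ-≤ n n≤m))

prefixProd-suc : ∀ {n} (a : Fin n → ℕ) {k} (k<n : k < n) →
                 prefixProd a (suc k) ≡ prefixProd a k * a (fromℕ< k<n)
prefixProd-suc {suc n} a {zero} k<n = *-comm (a Fin.zero) 1
prefixProd-suc {suc n} a {suc k} (s≤s k<n) =
  trans (cong (a Fin.zero *_) (prefixProd-suc (a ∘ Fin.suc) k<n)) (sym (*-assoc (a Fin.zero) _ _))

prefixSum-suc : ∀ {n} (a : Fin n → ℕ) {k} (k<n : k < n) →
                prefixSum a (suc k) ≡ prefixSum a k + a (fromℕ< k<n)
prefixSum-suc {suc n} a {zero} k<n = +-identityʳ (a Fin.zero)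
prefixSum-suc {suc n} a {suc k} (s≤s k<n) =
  trans (cong (a Fin.zero +_) (prefixSum-suc (a ∘ Fin.suc) k<n)) (sym (+-assoc (a Fin.zero) _ _))

prefixProd-positive : ∀ {n} (a : Fin n → ℕ) → (∀ i → 1 ≤ a i) → ∀ k → 1 ≤ prefixProd a k
prefixProd-positive a positive zero = ≤-refl
prefixProd-positive {zero} a positive (suc k) = ≤-refl
prefixProd-positive {suc n} a positive (suc k) =
  *-mono-≤ (positive Fin.zero) (prefixProd-positive (a ∘ Fin.suc) (positive ∘ Fin.suc) k)

last≤prefixProd : ∀ {n} (a : Fin n → ℕ) → (∀ i → 1 ≤ a i) → ∀ {k} (k<n : k < n) →
                  a (fromℕ< k<n) ≤ prefixProd a (suc k)
last≤prefixProd a positive {k} k<n = subst (a (fromℕ< k<n) ≤_) (sym (prefixProd-suc a k<n))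
  (m≤n*m (a (fromℕ< k<n)) (prefixProd a k) {{>-nonZero (prefixProd-positive a positive k)}})

-- Appending x to a prefix with product P and bound s + (1 + m) turns the excess
-- P − (s + 1 + m) into P x − (s + x + m), which is larger by (P − 1)(x − 1).
append-identity : ∀ s m P x → 1 ≤ P → 1 ≤ x →
                  (s + suc m) + P * x ≡ (s + x + m) + (P + (P ∸ 1) * (x ∸ 1))
append-identity s m (suc p) (suc y) _ _ = identity s m p y
  where
  identity : ∀ s m p y → (s + suc m) + suc p * suc y ≡ (s + suc y + m) + (suc p + p * y)
  identity = solve-∀

module Excess {n} (a : Fin n → ℕ) (positive : ∀ i → 1 ≤ a i) where

  bound : ℕ → ℕ
  bound k = prefixSum a k + (n ∸ k)

  excess : ℕ → ℤ
  excess k = prefixProd a k ⊖ bound k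

  gain : ∀ {k} → k < n → ℕ
  gain {k} k<n = (prefixProd a k ∸ 1) * (a (fromℕ< k<n) ∸ 1)

  excess-suc : ∀ {k} (k<n : k < n) → excess (suc k) ≡ (prefixProd a k + gain k<n) ⊖ bound k
  excess-suc {k} k<n = m+n≡o+p⇒n⊖o≡p⊖m {bound k} {prefixProd a (suc k)} {bound (suc k)} (begin
    bound k + prefixProd a (suc k)
      ≡⟨ cong₂ (λ b p → prefixSum a k + b + p) (+-∸-assoc 1 k<n) (prefixProd-suc a k<n) ⟩
    prefixSum a k + suc (n ∸ suc k) + prefixProd a k * x
      ≡⟨ append-identity (prefixSum a k) (n ∸ suc k) (prefixProd a k) x
           (prefixProd-positive a positive k) (positive _) ⟩
    prefixSum a k + x + (n ∸ suc k) + (prefixProd a k + gain k<n)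
      ≡⟨ cong (λ s → s + (n ∸ suc k) + (prefixProd a k + gain k<n)) (sym (prefixSum-suc a k<n)) ⟩
    bound (suc k) + (prefixProd a k + gain k<n) ∎)
    where
    open ≡-Reasoning
    x : ℕ
    x = a (fromℕ< k<n)

  excess-≤-suc : ∀ {k} (k<n : k < n) → excess k ≤ℤ excess (suc k)
  excess-≤-suc {k} k<n = subst (excess k ≤ℤ_) (sym (excess-suc k<n))
    (ℤ.⊖-monoˡ-≤ (bound k) (m≤m+n (prefixProd a k) (gain k<n)))

  excess-≡-suc : ∀ {k} (k<n : k < n) → a (fromℕ< k<n) ≤ 1 → excess k ≡ excess (suc k)
  excess-≡-suc {k} k<n x≤1 = begin
    prefixProd a k ⊖ bound k                 ≡⟨ cong (_⊖ bound k) (sym (+-identityʳ _)) ⟩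
    (prefixProd a k + 0) ⊖ bound k           ≡⟨ cong (λ g → (prefixProd a k + g) ⊖ bound k) gain≡0 ⟩
    (prefixProd a k + gain k<n) ⊖ bound k    ≡⟨ sym (excess-suc k<n) ⟩
    excess (suc k)                           ∎
    where
    open ≡-Reasoning
    gain≡0 : 0 ≡ gain k<n
    gain≡0 = sym (trans (cong ((prefixProd a k ∸ 1) *_) (m≤n⇒m∸n≡0 x≤1))
                        (*-zeroʳ (prefixProd a k ∸ 1)))

  excess-<-suc : ∀ {k} (k<n : k < n) → 2 ≤ prefixProd a k → 2 ≤ a (fromℕ< k<n) →
                 excess k <ℤ excess (suc k)
  excess-<-suc {k} k<n 2≤P 2≤x = subst (excess k <ℤ_) (sym (excess-suc k<n))
    (ℤ.⊖-monoˡ-< (bound k) (m<m+n (prefixProd a k) (*-mono-≤ (∸-monoˡ-≤ 1 2≤P) (∸-monoˡ-≤ 1 2≤x))))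

  excess≤excess-n : ∀ {k} → k ≤ n → excess k ≤ℤ excess n
  excess≤excess-n = stepwise⇒related {_∼_ = _≤ℤ_} ℤ.≤-refl ℤ.≤-trans excess
    (λ _ _ i<n → excess-≤-suc i<n)

  excess≡excess-n : ∀ {k} → (∀ i (i<n : i < n) → k ≤ i → a (fromℕ< i<n) ≤ 1) → k ≤ n →
                    excess k ≡ excess n
  excess≡excess-n ones = stepwise⇒related {_∼_ = _≡_} refl trans excess
    (λ i k≤i i<n → excess-≡-suc i<n (ones i i<n k≤i))

  excess-n≡0 : prefixProd a n ≡ prefixSum a n → excess n ≡ 0ℤ
  excess-n≡0 P≡S = begin
    prefixProd a n ⊖ (prefixSum a n + (n ∸ n)) ≡⟨ cong (λ d → prefixProd a n ⊖ (prefixSum a n + d)) (n∸n≡0 n) ⟩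
    prefixProd a n ⊖ (prefixSum a n + 0)       ≡⟨ cong₂ _⊖_ P≡S (+-identityʳ (prefixSum a n)) ⟩
    prefixSum a n ⊖ prefixSum a n              ≡⟨ ℤ.n⊖n≡0 (prefixSum a n) ⟩
    0ℤ                                         ∎
    where open ≡-Reasoning

theorem3p1 : (n : ℕ) → n ≥ 2 → (a : Fin n → ℕ)
    → (∀ i → 1 ≤ a i)
    → (∀ (i j : Fin n) → toℕ i ≤ toℕ j → a j ≤ a i)
    → prefixProd a n ≡ prefixSum a n
    → ((k : ℕ) → 1 ≤ k → k ≤ n → prefixProd a k ≤ prefixSum a k + (n ∸ k))
      × ((s : Fin n) → 1 < a s → (∀ (j : Fin n) → toℕ s < toℕ j → a j ≤ 1)
         → ((k : ℕ) → suc (toℕ s) ≤ k → k ≤ n → prefixProd a k ≡ prefixSum a k + (n ∸ k))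
           × ((k : ℕ) → 1 ≤ k → k < suc (toℕ s) → prefixProd a k < prefixSum a k + (n ∸ k)))
theorem3p1 n _ a positive antitone P≡S =
  prod≤bound , λ s 2≤aₛ ones → prod≡bound s ones , prod<bound s 2≤aₛ
  where
  open Excess a positive

  prod≤bound : ∀ k → 1 ≤ k → k ≤ n → prefixProd a k ≤ bound k
  prod≤bound k _ k≤n = m⊖n≤0⇒m≤n (subst (excess k ≤ℤ_) (excess-n≡0 P≡S) (excess≤excess-n k≤n))

  prod≡bound : (s : Fin n) → (∀ j → toℕ s < toℕ j → a j ≤ 1) →
               ∀ k → suc (toℕ s) ≤ k → k ≤ n → prefixProd a k ≡ bound k
  prod≡bound s ones k s<k k≤n =
    m⊖n≡0⇒m≡n (trans (excess≡excess-n ones-after-k k≤n) (excess-n≡0 P≡S))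
    where
    ones-after-k : ∀ i (i<n : i < n) → k ≤ i → a (fromℕ< i<n) ≤ 1
    ones-after-k i i<n k≤i = ones _ (subst (toℕ s <_) (sym (toℕ-fromℕ< i<n)) (<-≤-trans s<k k≤i))

  prod<bound : (s : Fin n) → 2 ≤ a s → ∀ k → 1 ≤ k → k < suc (toℕ s) → prefixProd a k < bound k
  prod<bound s 2≤aₛ k@(suc i) _ (s≤s k≤s) = m⊖n<0⇒m<n (subst (excess k <ℤ_) (excess-n≡0 P≡S)
    (ℤ.<-≤-trans (excess-<-suc k<n 2≤P (large k<n k≤s)) (excess≤excess-n k<n)))
    where
    k<n : k < n
    k<n = ≤-<-trans k≤s (toℕ<n s)
    i<n : i < n
    i<n = <-trans (n<1+n i) k<n
    large : ∀ {j} (j<n : j < n) → j ≤ toℕ s → 2 ≤ a (fromℕ< j<n)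
    large j<n j≤s = ≤-trans 2≤aₛ (antitone _ s (subst (_≤ toℕ s) (sym (toℕ-fromℕ< j<n)) j≤s))
    2≤P : 2 ≤ prefixProd a k
    2≤P = ≤-trans (large i<n (<⇒≤ k≤s)) (last≤prefixProd a positive i<n)
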